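{- For nonnegative integers $n,m$ let $$N_{n,m}(x)=\sum_{k=0}^n \left(\binom{n}{k}\binom{m}{k}-\binom{n}{k+1}\binom{m}{k-1}\right) x^k .$$ Then for any integers $m\geq 0$ and $n\geq 1$ we have the polynomial identity $$c_{n,m}(x)N_{n,m+1}(x)=a_{n,m}(x) N_{n,m}(x)+b_{n,m}(x) N_{n-1,m}(x),$$ where $$a_{n,m}(x)=(m+2-n)(m^2-n^2+4m+3)x-2n,$$ $$b_{n,m}(x)=n\big[(m+2-n)(m+1-n)x-2\big](x-1),$$ $$c_{n,m}(x)=(m+3)(m+2-n)(m+1-n)x.$$
   Context: Binomial coefficients $\binom{a}{b}$ are taken to be $0$ when $b<0$ or $b>a$. The polynomials $N_{n,m}(x)$ are called generalized Narayana polynomials. -}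

module Defs where

open import Data.Nat as ℕ using (ℕ; zero; suc; _∸_)
open import Data.Nat.Combinatorics using (_C_)
open import Data.Bool using (true; false)
open import Data.Integer using (ℤ; +_; _+_; _*_; _-_; -_)

-- Polynomials with integer coefficients, represented by their
-- coefficient sequences: p i is the coefficient of x^i.
Poly : Set
Poly = ℕ → ℤ

const : ℤ → Poly
const c zero    = c
const c (suc _) = + 0

X : Poly
X 1 = + 1
X _ = + 0

infixl 6 _⊕_ _⊖_
infixl 7 _⊗_

_⊕_ : Poly → Poly → Poly
(p ⊕ q) i = p i + q i

_⊖_ : Poly → Poly → Poly
(p ⊖ q) i = p i - q i

convAux : Poly → Poly → ℕ → ℕ → ℤ
convAux p q i zero    = + 0
convAux p q i (suc k) = convAux p q i k + p k * q (i ∸ k)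

_⊗_ : Poly → Poly → Poly
(p ⊗ q) i = convAux p q i (suc i)

-- binomial coefficient C(a, k-1), which is 0 when k - 1 < 0, i.e. k = 0
Cpred : ℕ → ℕ → ℕ
Cpred a zero    = 0
Cpred a (suc k) = a C k

N : ℕ → ℕ → Poly
N n m k with k ℕ.≤ᵇ n
... | true  = + ((n C k) ℕ.* (m C k)) - + ((n C suc k) ℕ.* Cpred m k)
... | false = + 0

ι : ℕ → ℤ
ι k = + k

a : ℕ → ℕ → Poly
a n m = const ((ι m + ι 2 - ι n) * (ι m * ι m - ι n * ι n + ι 4 * ι m + ι 3)) ⊗ X
        ⊖ const (ι 2 * ι n)

b : ℕ → ℕ → Poly
b n m = const (ι n) ⊗ (const ((ι m + ι 2 - ι n) * (ι m + ι 1 - ι n)) ⊗ X ⊖ const (ι 2))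
        ⊗ (X ⊖ const (ι 1))

c : ℕ → ℕ → Poly
c n m = const ((ι m + ι 3) * (ι m + ι 2 - ι n) * (ι m + ι 1 - ι n)) ⊗ X

-- Comparing coefficients of x^k and using Pascal's rule, both sides are written
-- through the binomials aⱼ = C(n-1, k+j-3) (j ≤ 4) and bⱼ = C(m, k+j-3) (j ≤ 3),
-- and the identity becomes the vanishing of a bilinear form in a and b.
-- Consecutive binomials satisfy (j+1) C(q, j+1) = (q-j) C(q, j), so each window
-- is proportional to an explicit profile vector built from these linear factors.
-- On the profiles the form vanishes by a polynomial identity in n, m and k, and
-- bilinearity carries this over to the binomial windows after multiplying by a
-- nonzero profile entry.

module Submission where

open import Defs
open import Data.Nat using (ℕ; suc; _≤_; _∸_)
open import Relation.Binary.PropositionalEquality using (_≡_)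

open import Algebra.Bundles.Raw using (RawRing)
open import Data.Bool using (true; false; T)
open import Data.Fin as Fin using (#_; toℕ)
open import Data.Integer as ℤ using (ℤ; +_)
import Data.Integer.Properties as ℤP
open import Data.Integer.Tactic.RingSolver using (solve-∀; ring)
open import Data.Nat as ℕ using (zero)
open import Data.Nat.Combinatorics using (_C_; nC1≡n; nCk+nC[k+1]≡[n+1]C[k+1]; k>n⇒nCk≡0)
import Data.Nat.Properties as ℕP
open import Data.Vec using (Vec; []; _∷_; lookup; map; tabulate)
open import Data.Vec.Properties using (lookup-map; lookup∘tabulate)
open import Data.Vec.Relation.Binary.Pointwise.Extensional using (ext; Pointwise-≡⇒≡)
open import Function using (_∘_)
open import Level using (0ℓ)
open import Relation.Binary.PropositionalEquality
  using (_≢_; refl; sym; trans; cong; cong₂; subst; _≗_; module ≡-Reasoning)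
import Tactic.RingSolver.NonReflective ring as Solver

-- Stated over an arbitrary raw ring so that the very same definitions can be
-- handed to the ring solver as syntax (instantiating with solver expressions).
module CoefficientWindows (R : RawRing 0ℓ 0ℓ) (lit : ℕ → RawRing.Carrier R) where
  open RawRing R

  infixl 6 _-_
  _-_ : Carrier → Carrier → Carrier
  x - y = x + - y

  scale : ∀ {n} → Carrier → Vec Carrier n → Vec Carrier n
  scale x = map (x *_)

  γ α β : Carrier → Carrier → Carrier
  γ n m = (m + lit 3) * (m + lit 2 - n) * (m + lit 1 - n)
  α n m = (m + lit 2 - n) * (m * m - n * n + lit 4 * m + lit 3)
  β n m = (m + lit 2 - n) * (m + lit 1 - n)

  -- With aⱼ = C(n-1, k+j-3) and bⱼ = C(m, k+j-3), this is the coefficient of x^k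
  -- in c N_{n,m+1} - (a N_{n,m} + b N_{n-1,m}); Pascal's rule has already been
  -- used to write C(n, ·) and C(m+1, ·) in terms of these.
  narayanaDefect : Carrier → Carrier → Vec Carrier 5 → Vec Carrier 4 → Carrier
  narayanaDefect n m (a₀ ∷ a₁ ∷ a₂ ∷ a₃ ∷ a₄ ∷ []) (b₀ ∷ b₁ ∷ b₂ ∷ b₃ ∷ []) =
    γ n m * ((a₂ + a₁) * (b₂ + b₁) - (a₃ + a₂) * (b₁ + b₀))
    - ((α n m * ((a₂ + a₁) * b₂ - (a₃ + a₂) * b₁) - lit 2 * n * ((a₃ + a₂) * b₃ - (a₄ + a₃) * b₂))
       + (lit 2 * n * (a₃ * b₃ - a₄ * b₂) - n * (β n m + lit 2) * (a₂ * b₂ - a₃ * b₁)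
          + n * β n m * (a₁ * b₁ - a₂ * b₀)))

  -- C(q, j+1) / C(q, j) = (q - j) / (j + 1), read at j = K - 3 + i.
  ratioDenominator : Carrier → ℕ → Carrier
  ratioDenominator K i = K - lit 2 + lit i

  ratioNumerator : Carrier → Carrier → ℕ → Carrier
  ratioNumerator q K i = lit 3 + q - K - lit i

  -- Entry j is (∏_{i<j} f i) * (∏_{j≤i<L} d i).
  profile : (d f : ℕ → Carrier) (L : ℕ) → Vec Carrier (suc L)
  profile d f zero    = 1# ∷ []
  profile d f (suc L) = d 0 * lookup q Fin.zero ∷ scale (f 0) q
    where q = profile (d ∘ suc) (f ∘ suc) L

solverExpressions : ℕ → RawRing 0ℓ 0ℓ
solverExpressions n = record
  { Carrier = Solver.Expr ℤ n
  ; _≈_     = _≡_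
  ; _+_     = Solver._⊕_
  ; _*_     = Solver._⊗_
  ; -_      = Solver.⊝_
  ; 0#      = Solver.Κ (+ 0)
  ; 1#      = Solver.Κ (+ 1)
  }

module Syntax (n : ℕ) = CoefficientWindows (solverExpressions n) (Solver.Κ ∘ +_)

open CoefficientWindows ℤ.+-*-rawRing ι
  using (scale; γ; α; β; narayanaDefect; ratioDenominator; ratioNumerator; profile)

open import Data.Integer using (_+_; _*_; _-_; -_)

shift : Poly → Poly
shift p zero    = + 0
shift p (suc i) = p i

shift-cong : ∀ {p q} → p ≗ q → shift p ≗ shift q
shift-cong p≗q zero    = refl
shift-cong p≗q (suc i) = p≗q i

[1+x]*_ : Poly → Poly
[1+x]* p = p ⊕ shift p

quadratic : ℤ → ℤ → ℤ → Poly
quadratic c₀ c₁ c₂ 0 = c₀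
quadratic c₀ c₁ c₂ 1 = c₁
quadratic c₀ c₁ c₂ 2 = c₂
quadratic c₀ c₁ c₂ _ = + 0

convAux-congˡ : ∀ {p p′} q i → p ≗ p′ → ∀ k → convAux p q i k ≡ convAux p′ q i k
convAux-congˡ q i p≗p′ zero    = refl
convAux-congˡ q i p≗p′ (suc k) = cong₂ (λ s t → s + t * q (i ∸ k)) (convAux-congˡ q i p≗p′ k) (p≗p′ k)

⊗-congˡ : ∀ {p p′} q → p ≗ p′ → (p ⊗ q) ≗ (p′ ⊗ q)
⊗-congˡ q p≗p′ i = convAux-congˡ q i p≗p′ (suc i)

convAux-beyond-degree : ∀ {p} q i d → (∀ j → p (d ℕ.+ j) ≡ + 0) →
                        ∀ j → convAux p q i (d ℕ.+ j) ≡ convAux p q i d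
convAux-beyond-degree q i d p≡0 zero    = cong (convAux _ q i) (ℕP.+-identityʳ d)
convAux-beyond-degree {p} q i d p≡0 (suc j) = begin
    convAux p q i (d ℕ.+ suc j)                        ≡⟨ cong (convAux p q i) (ℕP.+-suc d j) ⟩
    convAux p q i (d ℕ.+ j) + p (d ℕ.+ j) * q (i ∸ (d ℕ.+ j))
      ≡⟨ cong₂ _+_ (convAux-beyond-degree q i d p≡0 j) (cong (_* q (i ∸ (d ℕ.+ j))) (p≡0 j)) ⟩
    convAux p q i d + + 0                               ≡⟨ ℤP.+-identityʳ _ ⟩
    convAux p q i d                                     ∎
  where open ≡-Reasoning

const-⊗ : ∀ g q i → (const g ⊗ q) i ≡ g * q i
const-⊗ g q i = trans (convAux-beyond-degree q i 1 (λ _ → refl) i) (ℤP.+-identityˡ (g * q i))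

quadratic-⊗ : ∀ c₀ c₁ c₂ q k →
  (quadratic c₀ c₁ c₂ ⊗ q) k ≡ c₀ * q k + c₁ * shift q k + c₂ * shift (shift q) k
quadratic-⊗ c₀ c₁ c₂ q 0 = expand c₀ c₁ c₂ (q 0)
  where
  expand : ∀ c₀ c₁ c₂ x → + 0 + c₀ * x ≡ c₀ * x + c₁ * + 0 + c₂ * + 0
  expand = solve-∀
quadratic-⊗ c₀ c₁ c₂ q 1 = expand c₀ c₁ c₂ (q 1) (q 0)
  where
  expand : ∀ c₀ c₁ c₂ x y → + 0 + c₀ * x + c₁ * y ≡ c₀ * x + c₁ * y + c₂ * + 0
  expand = solve-∀
quadratic-⊗ c₀ c₁ c₂ q (suc (suc j)) =
  trans (convAux-beyond-degree q (2 ℕ.+ j) 3 (λ _ → refl) j)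
        (cong (λ s → s + c₁ * q (suc j) + c₂ * q j) (ℤP.+-identityˡ (c₀ * q (2 ℕ.+ j))))

c-⊗ : ∀ n m q k → (c n m ⊗ q) k ≡ γ (ι n) (ι m) * shift q k
c-⊗ n m q k = begin
    (c n m ⊗ q) k                                          ≡⟨ ⊗-congˡ q c≗quadratic k ⟩
    (quadratic (+ 0) g (+ 0) ⊗ q) k                        ≡⟨ quadratic-⊗ (+ 0) g (+ 0) q k ⟩
    + 0 * q k + g * shift q k + + 0 * shift (shift q) k    ≡⟨ cleanup g (q k) (shift q k) (shift (shift q) k) ⟩
    g * shift q k                                          ∎
  where
  open ≡-Reasoning
  g = γ (ι n) (ι m)
  coefficient : ∀ i → g * X i ≡ quadratic (+ 0) g (+ 0) i
  coefficient 0                   = ℤP.*-zeroʳ g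
  coefficient 1                   = ℤP.*-identityʳ g
  coefficient 2                   = ℤP.*-zeroʳ g
  coefficient (suc (suc (suc i))) = ℤP.*-zeroʳ g
  c≗quadratic : c n m ≗ quadratic (+ 0) g (+ 0)
  c≗quadratic i = trans (const-⊗ g X i) (coefficient i)
  cleanup : ∀ g x y z → + 0 * x + g * y + + 0 * z ≡ g * y
  cleanup = solve-∀

a-⊗ : ∀ n m q k → (a n m ⊗ q) k ≡ α (ι n) (ι m) * shift q k - ι 2 * ι n * q k
a-⊗ n m q k = begin
    (a n m ⊗ q) k                                          ≡⟨ ⊗-congˡ q a≗quadratic k ⟩
    (quadratic (- t) g (+ 0) ⊗ q) k                        ≡⟨ quadratic-⊗ (- t) g (+ 0) q k ⟩
    - t * q k + g * shift q k + + 0 * shift (shift q) k    ≡⟨ cleanup g t (q k) (shift q k) (shift (shift q) k) ⟩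
    g * shift q k - t * q k                                ∎
  where
  open ≡-Reasoning
  g = α (ι n) (ι m)
  t = ι 2 * ι n
  coefficient : ∀ i → g * X i - const t i ≡ quadratic (- t) g (+ 0) i
  coefficient 0                   = trans (cong (_- t) (ℤP.*-zeroʳ g)) (ℤP.+-identityˡ (- t))
  coefficient 1                   = trans (ℤP.+-identityʳ (g * + 1)) (ℤP.*-identityʳ g)
  coefficient 2                   = trans (ℤP.+-identityʳ (g * + 0)) (ℤP.*-zeroʳ g)
  coefficient (suc (suc (suc i))) = trans (ℤP.+-identityʳ (g * + 0)) (ℤP.*-zeroʳ g)
  a≗quadratic : a n m ≗ quadratic (- t) g (+ 0)
  a≗quadratic i = trans (cong (_- const t i) (const-⊗ g X i)) (coefficient i)
  cleanup : ∀ g t x y z → - t * x + g * y + + 0 * z ≡ g * y - t * x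
  cleanup = solve-∀

b-⊗ : ∀ n m q k →
  (b n m ⊗ q) k ≡ ι 2 * ι n * q k - ι n * (β (ι n) (ι m) + ι 2) * shift q k
                  + ι n * β (ι n) (ι m) * shift (shift q) k
b-⊗ n m q k = begin
    (b n m ⊗ q) k                                           ≡⟨ ⊗-congˡ q b≗quadratic k ⟩
    (quadratic t (- (ν * (g + ι 2))) (ν * g) ⊗ q) k         ≡⟨ quadratic-⊗ t (- (ν * (g + ι 2))) (ν * g) q k ⟩
    t * q k + - (ν * (g + ι 2)) * shift q k + ν * g * shift (shift q) k
      ≡⟨ cleanup t (ν * (g + ι 2)) (ν * g) (q k) (shift q k) (shift (shift q) k) ⟩
    t * q k - ν * (g + ι 2) * shift q k + ν * g * shift (shift q) k ∎
  where
  open ≡-Reasoning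
  ν = ι n
  g = β (ι n) (ι m)
  t = ι 2 * ν
  Y Z : Poly
  Y = const g ⊗ X ⊖ const (ι 2)
  Z = X ⊖ const (ι 1)
  vanish : ∀ ν g → ν * (g * + 0 - + 0) ≡ + 0
  vanish = solve-∀
  Y-coefficient : ∀ j → ν * (g * X j - const (ι 2) j) ≡ quadratic (- t) (ν * g) (+ 0) j
  Y-coefficient 0                   = expand ν g
    where expand : ∀ ν g → ν * (g * + 0 - + 2) ≡ - (+ 2 * ν)
          expand = solve-∀
  Y-coefficient 1                   = expand ν g
    where expand : ∀ ν g → ν * (g * + 1 - + 0) ≡ ν * g
          expand = solve-∀
  Y-coefficient 2                   = vanish ν g
  Y-coefficient (suc (suc (suc j))) = vanish ν g
  νY≗quadratic : const ν ⊗ Y ≗ quadratic (- t) (ν * g) (+ 0)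
  νY≗quadratic j =
    trans (const-⊗ ν Y j) (trans (cong (λ y → ν * (y - const (ι 2) j)) (const-⊗ g X j)) (Y-coefficient j))
  coefficient : ∀ i → - t * Z i + ν * g * shift Z i + + 0 * shift (shift Z) i
                      ≡ quadratic t (- (ν * (g + ι 2))) (ν * g) i
  coefficient 0                   = expand ν g
    where expand : ∀ ν g → - (+ 2 * ν) * (+ 0 - + 1) + ν * g * + 0 + + 0 * + 0 ≡ + 2 * ν
          expand = solve-∀
  coefficient 1                   = expand ν g
    where expand : ∀ ν g → - (+ 2 * ν) * (+ 1 - + 0) + ν * g * (+ 0 - + 1) + + 0 * + 0 ≡ - (ν * (g + + 2))
          expand = solve-∀
  coefficient 2                   = expand ν g
    where expand : ∀ ν g → - (+ 2 * ν) * (+ 0 - + 0) + ν * g * (+ 1 - + 0) + + 0 * (+ 0 - + 1) ≡ ν * g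
          expand = solve-∀
  coefficient (suc (suc (suc i))) = expand ν g (Z (suc i))
    where expand : ∀ ν g z → - (+ 2 * ν) * (+ 0 - + 0) + ν * g * (+ 0 - + 0) + + 0 * z ≡ + 0
          expand = solve-∀
  b≗quadratic : b n m ≗ quadratic t (- (ν * (g + ι 2))) (ν * g)
  b≗quadratic i = trans (⊗-congˡ Z νY≗quadratic i) (trans (quadratic-⊗ (- t) (ν * g) (+ 0) Z i) (coefficient i))
  cleanup : ∀ t u v x y z → t * x + - u * y + v * z ≡ t * x - u * y + v * z
  cleanup = solve-∀

pascalRow : ℕ → Poly
pascalRow n k = + (n C k)

pascalRow-suc : ∀ n → pascalRow (suc n) ≗ [1+x]* pascalRow n
pascalRow-suc n zero    = refl
pascalRow-suc n (suc k) = begin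
    + (suc n C suc k)              ≡⟨ cong +_ (nCk+nC[k+1]≡[n+1]C[k+1] n k) ⟨
    + (n C k ℕ.+ n C suc k)        ≡⟨ cong +_ (ℕP.+-comm (n C k) (n C suc k)) ⟩
    + (n C suc k ℕ.+ n C k)        ≡⟨ ℤP.pos-+ (n C suc k) (n C k) ⟩
    + (n C suc k) + + (n C k)      ∎
  where open ≡-Reasoning

binomial-ratio : ∀ n k → + suc k * + (n C suc k) ≡ (+ n - + k) * + (n C k)
binomial-ratio zero    zero    = refl
binomial-ratio zero    (suc k) = trans (ℤP.*-zeroʳ (+ suc (suc k))) (sym (ℤP.*-zeroʳ (+ 0 - + suc k)))
binomial-ratio (suc n) zero    = trans (cong (+ 1 *_) (cong +_ (nC1≡n (suc n)))) (expand (+ suc n))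
  where
  expand : ∀ n → + 1 * n ≡ (n - + 0) * + 1
  expand = solve-∀
binomial-ratio (suc n) (suc k) = begin
    + suc (suc k) * + (suc n C suc (suc k))             ≡⟨ cong (+ suc (suc k) *_) (pascalRow-suc n (suc (suc k))) ⟩
    + suc (suc k) * (+ c₂ + + c₁)                        ≡⟨ split (+ k) (+ c₁) (+ c₂) ⟩
    + suc (suc k) * + c₂ + (+ suc k * + c₁ + + c₁)
      ≡⟨ cong₂ (λ u v → u + (v + + c₁)) (binomial-ratio n (suc k)) (binomial-ratio n k) ⟩
    (+ n - + suc k) * + c₁ + ((+ n - + k) * + c₀ + + c₁) ≡⟨ collect (+ n) (+ k) (+ c₀) (+ c₁) ⟩
    (+ suc n - + suc k) * (+ c₁ + + c₀)                  ≡⟨ cong ((+ suc n - + suc k) *_) (pascalRow-suc n (suc k)) ⟨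
    (+ suc n - + suc k) * + (suc n C suc k)              ∎
  where
  open ≡-Reasoning
  c₀ = n C k
  c₁ = n C suc k
  c₂ = n C suc (suc k)
  split : ∀ k c₁ c₂ → (+ 2 + k) * (c₂ + c₁) ≡ (+ 2 + k) * c₂ + ((+ 1 + k) * c₁ + c₁)
  split = solve-∀
  collect : ∀ n k c₀ c₁ → (n - (+ 1 + k)) * c₁ + ((n - k) * c₀ + c₁) ≡ (+ 1 + n - (+ 1 + k)) * (c₁ + c₀)
  collect = solve-∀

-- Three leading zeros: paddedRow n i = C(n, i - 3), so that every binomial
-- C(n, k + j - 3) met at coefficient k has a natural-number index.
paddedRow : ℕ → Poly
paddedRow n = shift (shift (shift (pascalRow n)))

paddedRow-suc : ∀ n → paddedRow (suc n) ≗ [1+x]* paddedRow n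
paddedRow-suc n 0                   = refl
paddedRow-suc n 1                   = refl
paddedRow-suc n 2                   = refl
paddedRow-suc n (suc (suc (suc j))) = pascalRow-suc n j

paddedRow-recurrence : ∀ q j → (+ j - + 2) * paddedRow q (suc j) ≡ (+ 3 + + q - + j) * paddedRow q j
paddedRow-recurrence q 0                   = sym (ℤP.*-zeroʳ (+ 3 + + q - + 0))
paddedRow-recurrence q 1                   = sym (ℤP.*-zeroʳ (+ 3 + + q - + 1))
paddedRow-recurrence q 2                   = sym (ℤP.*-zeroʳ (+ 3 + + q - + 2))
paddedRow-recurrence q (suc (suc (suc t))) =
  trans (binomial-ratio q t) (cong (_* + (q C t)) (sym (cancel (+ q) (+ t))))
  where
  cancel : ∀ q t → + 3 + q - (+ 3 + t) ≡ q - t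
  cancel = solve-∀

paddedRow-window-recurrence : ∀ q k i →
  ratioDenominator (ι k) i * paddedRow q (suc i ℕ.+ k) ≡ ratioNumerator (ι q) (ι k) i * paddedRow q (i ℕ.+ k)
paddedRow-window-recurrence q k i = begin
    ratioDenominator (ι k) i * paddedRow q (suc i ℕ.+ k)   ≡⟨ cong (_* paddedRow q (suc i ℕ.+ k)) denominator ⟩
    (+ (i ℕ.+ k) - + 2) * paddedRow q (suc i ℕ.+ k)        ≡⟨ paddedRow-recurrence q (i ℕ.+ k) ⟩
    (+ 3 + + q - + (i ℕ.+ k)) * paddedRow q (i ℕ.+ k)      ≡⟨ cong (_* paddedRow q (i ℕ.+ k)) numerator ⟨
    ratioNumerator (ι q) (ι k) i * paddedRow q (i ℕ.+ k)   ∎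
  where
  open ≡-Reasoning
  reorderᵈ : ∀ i k → k - + 2 + i ≡ i + k - + 2
  reorderᵈ = solve-∀
  reorderⁿ : ∀ q i k → + 3 + q - k - i ≡ + 3 + q - (i + k)
  reorderⁿ = solve-∀
  denominator : ratioDenominator (ι k) i ≡ + (i ℕ.+ k) - + 2
  denominator = trans (reorderᵈ (+ i) (+ k)) (cong (_- + 2) (sym (ℤP.pos-+ i k)))
  numerator : ratioNumerator (ι q) (ι k) i ≡ + 3 + + q - + (i ℕ.+ k)
  numerator = trans (reorderⁿ (+ q) (+ i) (+ k)) (cong (λ j → + 3 + + q - j) (sym (ℤP.pos-+ i k)))

narayanaForm : Poly → Poly → Poly
narayanaForm p q i = p i * q i - p (suc i) * shift q i

narayanaForm-cong : ∀ {p p′ q q′} → p ≗ p′ → q ≗ q′ → narayanaForm p q ≗ narayanaForm p′ q′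
narayanaForm-cong p≗p′ q≗q′ i =
  cong₂ _-_ (cong₂ _*_ (p≗p′ i) (q≗q′ i)) (cong₂ _*_ (p≗p′ (suc i)) (shift-cong q≗q′ i))

shift-narayanaForm : ∀ p q → shift (narayanaForm p q) ≗ narayanaForm (shift p) (shift q)
shift-narayanaForm p q zero    = sym (cong (λ x → + 0 - x) (ℤP.*-zeroʳ (p 0)))
shift-narayanaForm p q (suc i) = refl

Cpred≡shift-pascalRow : ∀ m k → + Cpred m k ≡ shift (pascalRow m) k
Cpred≡shift-pascalRow m zero    = refl
Cpred≡shift-pascalRow m (suc k) = refl

≤ᵇ≡false⇒> : ∀ {k n} → (k ℕ.≤ᵇ n) ≡ false → n ℕ.< k
≤ᵇ≡false⇒> k≤ᵇn≡false = ℕP.≰⇒> (λ k≤n → subst T k≤ᵇn≡false (ℕP.≤⇒≤ᵇ k≤n))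

N-untruncated : ∀ n m k → N n m k ≡ + ((n C k) ℕ.* (m C k)) - + ((n C suc k) ℕ.* Cpred m k)
N-untruncated n m k with k ℕ.≤ᵇ n in k≤ᵇn
... | true rewrite k≤ᵇn = refl -- n C k unfolds to a test on k ≤ᵇ n, abstracted on the right only
... | false =
  sym (cong (λ z → + 0 - + (z ℕ.* Cpred m k)) (k>n⇒nCk≡0 {n = n} {k = suc k} (ℕP.m<n⇒m<1+n (≤ᵇ≡false⇒> k≤ᵇn))))

N≗narayanaForm : ∀ n m → N n m ≗ narayanaForm (pascalRow n) (pascalRow m)
N≗narayanaForm n m k = trans (N-untruncated n m k) (cong₂ _-_ (ℤP.pos-* (n C k) (m C k))
  (trans (ℤP.pos-* (n C suc k) (Cpred m k)) (cong (+ (n C suc k) *_) (Cpred≡shift-pascalRow m k))))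

-- Definitionally, narayanaForm (shift p) (shift q) k equals narayanaForm on the
-- thrice-shifted sequences at 2 + k, and likewise one level further down.
shift-N-padded : ∀ n m k → shift (N n m) k ≡ narayanaForm (paddedRow n) (paddedRow m) (2 ℕ.+ k)
shift-N-padded n m k = trans (shift-cong (N≗narayanaForm n m) k) (shift-narayanaForm _ _ k)

shift²-N-padded : ∀ n m k → shift (shift (N n m)) k ≡ narayanaForm (paddedRow n) (paddedRow m) (1 ℕ.+ k)
shift²-N-padded n m k = trans (shift-cong (shift-N-padded n m) k) (shift-narayanaForm _ _ k)

Proportional : ∀ {n} → Vec ℤ n → Vec ℤ n → Set
Proportional u v = ∀ i j → lookup u i * lookup v j ≡ lookup u j * lookup v i

proportional⇒scale : ∀ {n} {u v : Vec ℤ n} → Proportional u v →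
                     ∀ i → scale (lookup v i) u ≡ scale (lookup u i) v
proportional⇒scale {u = u} {v} u∝v i = Pointwise-≡⇒≡ (ext λ j → begin
    lookup (scale (lookup v i) u) j    ≡⟨ lookup-map j _ u ⟩
    lookup v i * lookup u j            ≡⟨ ℤP.*-comm (lookup v i) (lookup u j) ⟩
    lookup u j * lookup v i            ≡⟨ u∝v j i ⟩
    lookup u i * lookup v j            ≡⟨ lookup-map j _ v ⟨
    lookup (scale (lookup u i) v) j    ∎)
  where open ≡-Reasoning

Bilinear : ∀ {s t} → (Vec ℤ s → Vec ℤ t → ℤ) → Set
Bilinear F = ∀ x y u v → F (scale x u) (scale y v) ≡ x * y * F u v

-- Multiplying by the pivot entries qᵢ rⱼ turns (a, b) into (aᵢ q, bⱼ r).
bilinear-vanishing : ∀ {s t} {F : Vec ℤ s → Vec ℤ t → ℤ} {a q b r} → Bilinear F → F q r ≡ + 0 →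
  Proportional a q → Proportional b r → ∀ i j → lookup q i ≢ + 0 → lookup r j ≢ + 0 → F a b ≡ + 0
bilinear-vanishing {F = F} {a} {q} {b} {r} F-bilinear Fqr≡0 a∝q b∝r i j qᵢ≢0 rⱼ≢0 =
  ℤP.*-cancelˡ-≡ (lookup q i * lookup r j) (F a b) (+ 0)
    {{ℤP.i*j≢0 (lookup q i) (lookup r j) {{ℤ.≢-nonZero qᵢ≢0}} {{ℤ.≢-nonZero rⱼ≢0}}}}
    (trans scaled (sym (ℤP.*-zeroʳ (lookup q i * lookup r j))))
  where
  open ≡-Reasoning
  scaled : lookup q i * lookup r j * F a b ≡ + 0
  scaled = begin
    lookup q i * lookup r j * F a b                       ≡⟨ F-bilinear (lookup q i) (lookup r j) a b ⟨
    F (scale (lookup q i) a) (scale (lookup r j) b)       ≡⟨ cong₂ F (proportional⇒scale a∝q i) (proportional⇒scale b∝r j) ⟩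
    F (scale (lookup a i) q) (scale (lookup b j) r)       ≡⟨ F-bilinear (lookup a i) (lookup b j) q r ⟩
    lookup a i * lookup b j * F q r                       ≡⟨ cong (lookup a i * lookup b j *_) Fqr≡0 ⟩
    lookup a i * lookup b j * + 0                         ≡⟨ ℤP.*-zeroʳ (lookup a i * lookup b j) ⟩
    + 0                                                   ∎

window : (ℕ → ℤ) → (L : ℕ) → Vec ℤ (suc L)
window x L = tabulate (λ j → x (toℕ j))

window-proportional : ∀ {d f x : ℕ → ℤ} → (∀ i → d i * x (suc i) ≡ f i * x i) →
  ∀ L → Proportional (window x L) (profile d f L)
window-proportional recurrence zero    Fin.zero Fin.zero = refl
window-proportional {d} {f} {x} recurrence (suc L) = proportional
  where
  open ≡-Reasoning
  u = window (x ∘ suc) L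
  q = profile (d ∘ suc) (f ∘ suc) L
  u∝q : Proportional u q
  u∝q = window-proportional (recurrence ∘ suc) L
  u₀≡x₁ : lookup u Fin.zero ≡ x 1
  u₀≡x₁ = lookup∘tabulate {n = suc L} (x ∘ suc ∘ toℕ) Fin.zero
  head-row : ∀ j → x 0 * (f 0 * lookup q j) ≡ lookup u j * (d 0 * lookup q Fin.zero)
  head-row j = begin
    x 0 * (f 0 * lookup q j)               ≡⟨ swap (x 0) (f 0) (lookup q j) ⟩
    f 0 * x 0 * lookup q j                 ≡⟨ cong (_* lookup q j) (recurrence 0) ⟨
    d 0 * x 1 * lookup q j                 ≡⟨ cong (λ z → d 0 * z * lookup q j) u₀≡x₁ ⟨
    d 0 * lookup u Fin.zero * lookup q j   ≡⟨ ℤP.*-assoc (d 0) _ _ ⟩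
    d 0 * (lookup u Fin.zero * lookup q j) ≡⟨ cong (d 0 *_) (u∝q Fin.zero j) ⟩
    d 0 * (lookup u j * lookup q Fin.zero) ≡⟨ rotate (d 0) (lookup u j) (lookup q Fin.zero) ⟩
    lookup u j * (d 0 * lookup q Fin.zero) ∎
    where
    swap : ∀ a b c → a * (b * c) ≡ b * a * c
    swap = solve-∀
    rotate : ∀ a b c → a * (b * c) ≡ b * (a * c)
    rotate = solve-∀
  tail-rows : ∀ i j → lookup u i * (f 0 * lookup q j) ≡ lookup u j * (f 0 * lookup q i)
  tail-rows i j = begin
    lookup u i * (f 0 * lookup q j)  ≡⟨ rotate (lookup u i) (f 0) (lookup q j) ⟩
    f 0 * (lookup u i * lookup q j)  ≡⟨ cong (f 0 *_) (u∝q i j) ⟩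
    f 0 * (lookup u j * lookup q i)  ≡⟨ rotate (f 0) (lookup u j) (lookup q i) ⟩
    lookup u j * (f 0 * lookup q i)  ∎
    where
    rotate : ∀ a b c → a * (b * c) ≡ b * (a * c)
    rotate = solve-∀
  proportional : Proportional (window x (suc L)) (profile d f (suc L))
  proportional Fin.zero    Fin.zero    = refl
  proportional Fin.zero    (Fin.suc j) = trans (cong (x 0 *_) (lookup-map j _ q)) (head-row j)
  proportional (Fin.suc i) Fin.zero    = sym (trans (cong (x 0 *_) (lookup-map i _ q)) (head-row i))
  proportional (Fin.suc i) (Fin.suc j) =
    trans (cong (lookup u i *_) (lookup-map j _ q)) (trans (tail-rows i j) (cong (lookup u j *_) (sym (lookup-map i _ q))))

narayanaDefect-bilinear : ∀ n m → Bilinear (narayanaDefect n m)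
narayanaDefect-bilinear n m x y (a₀ ∷ a₁ ∷ a₂ ∷ a₃ ∷ a₄ ∷ []) (b₀ ∷ b₁ ∷ b₂ ∷ b₃ ∷ []) =
  Solver.solve 13
    (λ n m x y a₀ a₁ a₂ a₃ a₄ b₀ b₁ b₂ b₃ →
       let a = a₀ ∷ a₁ ∷ a₂ ∷ a₃ ∷ a₄ ∷ []; b = b₀ ∷ b₁ ∷ b₂ ∷ b₃ ∷ [] in
       S.narayanaDefect n m (S.scale x a) (S.scale y b) Solver.⊜ x Solver.⊗ y Solver.⊗ S.narayanaDefect n m a b)
    refl n m x y a₀ a₁ a₂ a₃ a₄ b₀ b₁ b₂ b₃
  where module S = Syntax 13

narayanaDefect-profiles≡0 : ∀ p m k →
  narayanaDefect (ι 1 + p) m (profile (ratioDenominator k) (ratioNumerator p k) 4)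
                             (profile (ratioDenominator k) (ratioNumerator m k) 3) ≡ + 0
narayanaDefect-profiles≡0 = Solver.solve 3 (λ p m k →
    S.narayanaDefect (Solver.Κ (+ 1) Solver.⊕ p) m (S.profile (S.ratioDenominator k) (S.ratioNumerator p k) 4)
                                            (S.profile (S.ratioDenominator k) (S.ratioNumerator m k) 3)
    Solver.⊜ Solver.Κ (+ 0))
  refl
  where module S = Syntax 3

binomialWindow : (q k L : ℕ) → Vec ℤ (suc L)
binomialWindow q k = window (λ i → paddedRow q (i ℕ.+ k))

binomialProfile : (q k L : ℕ) → Vec ℤ (suc L)
binomialProfile q k = profile (ratioDenominator (ι k)) (ratioNumerator (ι q) (ι k))

binomialWindow-proportional : ∀ q k L → Proportional (binomialWindow q k L) (binomialProfile q k L)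
binomialWindow-proportional q k =
  window-proportional {ratioDenominator (ι k)} {ratioNumerator (ι q) (ι k)} (paddedRow-window-recurrence q k)

narayanaDefect-window≡0-by-pivots : ∀ p m k i j →
  lookup (binomialProfile p k 4) i ≢ + 0 → lookup (binomialProfile m k 3) j ≢ + 0 →
  narayanaDefect (ι (suc p)) (ι m) (binomialWindow p k 4) (binomialWindow m k 3) ≡ + 0
narayanaDefect-window≡0-by-pivots p m k =
  bilinear-vanishing (narayanaDefect-bilinear (ι (suc p)) (ι m)) (narayanaDefect-profiles≡0 (ι p) (ι m) (ι k))
    (binomialWindow-proportional p k 4) (binomialWindow-proportional m k 3)

-- At the pivot j = 3 ∸ k every factor of the profile entry is a positive integer.
narayanaDefect-window≡0 : ∀ p m k →
  narayanaDefect (ι (suc p)) (ι m) (binomialWindow p k 4) (binomialWindow m k 3) ≡ + 0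
narayanaDefect-window≡0 p m 0 = narayanaDefect-window≡0-by-pivots p m 0 (# 3) (# 3) (λ ()) (λ ())
narayanaDefect-window≡0 p m 1 = narayanaDefect-window≡0-by-pivots p m 1 (# 2) (# 2) (λ ()) (λ ())
narayanaDefect-window≡0 p m 2 = narayanaDefect-window≡0-by-pivots p m 2 (# 1) (# 1) (λ ()) (λ ())
narayanaDefect-window≡0 p m (suc (suc (suc t))) =
  narayanaDefect-window≡0-by-pivots p m (3 ℕ.+ t) (# 0) (# 0) (λ ()) (λ ())

-- On the binomial windows at k, narayanaDefect unfolds definitionally to the
-- difference of the two middle expressions of the chain below.
N-coefficient-recurrence : ∀ p m k →
  let ν = ι (suc p); g = β ν (ι m) in
  γ ν (ι m) * shift (N (suc p) (suc m)) k
    ≡ (α ν (ι m) * shift (N (suc p) m) k - ι 2 * ν * N (suc p) m k)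
      + (ι 2 * ν * N p m k - ν * (g + ι 2) * shift (N p m) k + ν * g * shift (shift (N p m)) k)
N-coefficient-recurrence p m k = begin
    γ′ * shift (N n (suc m)) k                        ≡⟨ cong (γ′ *_) N′₁ ⟩
    γ′ * narayanaForm ([1+x]* A) ([1+x]* B) (2 ℕ.+ k) ≡⟨ ℤP.i-j≡0⇒i≡j _ _ (narayanaDefect-window≡0 p m k) ⟩
    (α′ * narayanaForm ([1+x]* A) B (2 ℕ.+ k) - t * narayanaForm ([1+x]* A) B (3 ℕ.+ k))
      + (t * narayanaForm A B (3 ℕ.+ k) - s * narayanaForm A B (2 ℕ.+ k) + u * narayanaForm A B (1 ℕ.+ k))
      ≡⟨ cong₂ _+_ (cong₂ _-_ (cong (α′ *_) N₁) (cong (t *_) N₀))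
                   (cong₂ _+_ (cong₂ _-_ (cong (t *_) M₀) (cong (s *_) M₁)) (cong (u *_) M₂)) ⟨
    (α′ * shift (N n m) k - t * N n m k)
      + (t * N p m k - s * shift (N p m) k + u * shift (shift (N p m)) k) ∎
  where
  open ≡-Reasoning
  n = suc p
  ν = ι n
  γ′ = γ ν (ι m)
  α′ = α ν (ι m)
  t = ι 2 * ν
  s = ν * (β ν (ι m) + ι 2)
  u = ν * β ν (ι m)
  A = paddedRow p
  B = paddedRow m
  pascalˡ : narayanaForm (paddedRow n) B ≗ narayanaForm ([1+x]* A) B
  pascalˡ = narayanaForm-cong (paddedRow-suc p) (λ _ → refl)
  N′₁ : shift (N n (suc m)) k ≡ narayanaForm ([1+x]* A) ([1+x]* B) (2 ℕ.+ k)
  N′₁ = trans (shift-N-padded n (suc m) k) (narayanaForm-cong (paddedRow-suc p) (paddedRow-suc m) (2 ℕ.+ k))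
  N₀ : N n m k ≡ narayanaForm ([1+x]* A) B (3 ℕ.+ k)
  N₀ = trans (N≗narayanaForm n m k) (pascalˡ (3 ℕ.+ k))
  N₁ : shift (N n m) k ≡ narayanaForm ([1+x]* A) B (2 ℕ.+ k)
  N₁ = trans (shift-N-padded n m k) (pascalˡ (2 ℕ.+ k))
  M₀ : N p m k ≡ narayanaForm A B (3 ℕ.+ k)
  M₀ = N≗narayanaForm p m k
  M₁ : shift (N p m) k ≡ narayanaForm A B (2 ℕ.+ k)
  M₁ = shift-N-padded p m k
  M₂ : shift (shift (N p m)) k ≡ narayanaForm A B (1 ℕ.+ k)
  M₂ = shift²-N-padded p m k

theorem2p1 : (n m : ℕ) → 1 ≤ n → (k : ℕ) →
    (c n m ⊗ N n (suc m)) k ≡ (a n m ⊗ N n m ⊕ b n m ⊗ N (n ∸ 1) m) k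
theorem2p1 (suc p) m _ k =
  trans (c-⊗ n m (N n (suc m)) k)
        (trans (N-coefficient-recurrence p m k) (sym (cong₂ _+_ (a-⊗ n m (N n m) k) (b-⊗ n m (N p m) k))))
  where n = suc p
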